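{- Let $G$ be an interval graph with $n$ vertices, let $k\ge 2$ be the maximum clique size of $G$, and suppose that in the left ordering of $G$ each vertex is adjacent to its successor. Then $G$ contains an induced subgraph $H$ with at least $f_2(n,k)=n^{\frac{1}{k-1}}$ vertices such that in the (induced) left ordering of $H$ each vertex is adjacent to its successor, and $H$ has no simplicial vertices other than the first and the last vertex of this ordering.
   Context: An interval graph is the intersection graph of a family of intervals on the real line. Fix an interval representation in which vertex $v$ corresponds to $I(v)=[l(v),r(v)]$, with all endpoints pairwise distinct. The left ordering is the ordering of the vertices with $v<w$ iff $l(v)<l(w)$; an induced subgraph inherits the restricted ordering. A vertex is simplicial if its neighborhood is a clique. -}

module Defs where

open import Data.Nat using (ℕ; _≤_; _<_)
open import Data.Fin using (Fin)
open import Data.Fin.Subset using (Subset; _∈_; ∣_∣)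
open import Data.Product using (Σ; _×_)
open import Relation.Binary.PropositionalEquality using (_≡_; _≢_)
open import Relation.Nullary using (¬_)

-- An interval representation of a graph on vertex set Fin n:
-- vertex v ↦ I(v) = [l v , r v], all 2n endpoints pairwise distinct.
-- (Endpoints are taken in ℕ.)
record IntervalRep (n : ℕ) : Set where
  field
    l r   : Fin n → ℕ
    l<r   : ∀ v → l v < r v
    l-inj : ∀ v w → l v ≡ l w → v ≡ w
    r-inj : ∀ v w → r v ≡ r w → v ≡ w
    l≢r   : ∀ v w → l v ≢ r w
open IntervalRep public

module _ {n : ℕ} (R : IntervalRep n) where

  Adj : Fin n → Fin n → Set
  Adj v w = v ≢ w × (l R v ≤ r R w) × (l R w ≤ r R v)

  IsClique : Subset n → Set
  IsClique S = ∀ v w → v ∈ S → w ∈ S → v ≢ w → Adj v w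

  MaxCliqueSize : ℕ → Set
  MaxCliqueSize k =
    (Σ (Subset n) λ S → IsClique S × ∣ S ∣ ≡ k) × (∀ S → IsClique S → ∣ S ∣ ≤ k)

  Successor : Subset n → Fin n → Fin n → Set
  Successor S v w = v ∈ S × w ∈ S × l R v < l R w
    × (∀ u → u ∈ S → ¬ (l R v < l R u × l R u < l R w))

  ConsecAdj : Subset n → Set
  ConsecAdj S = ∀ v w → Successor S v w → Adj v w

  Simplicial : Subset n → Fin n → Set
  Simplicial S v = v ∈ S ×
    (∀ a b → a ∈ S → b ∈ S → Adj v a → Adj v b → a ≢ b → Adj a b)

  FirstIn : Subset n → Fin n → Set
  FirstIn S v = v ∈ S × (∀ u → u ∈ S → l R v ≤ l R u)

  LastIn : Subset n → Fin n → Set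
  LastIn S v = v ∈ S × (∀ u → u ∈ S → l R u ≤ l R v)

module Submission where

-- We prove, by induction on c, that every vertex set S with consecutive
-- adjacency and clique number ≤ c has an admissible H with ∣S∣ ≤ ∣H∣^(c-1).
-- For the step, let f be the first vertex of S and g its later neighbour that
-- starts last. The vertices after f up to g are all neighbours of f, so they
-- have clique number ≤ c-1 and the induction hypothesis applies to them; the
-- vertices from g on form a smaller set to which we recurse, and prepending f
-- to the admissible path found there keeps it admissible, because g is the only
-- neighbour of f on it. Unfolding this recursion decomposes S into f and at
-- most ∣path∣-1 blocks of size ≤ ∣H∣^(c-2) each, whence the bound.

open import Defs
open import Data.Nat using (ℕ; _≤_; _^_; _∸_)
open import Data.Fin using (Fin)
open import Data.Fin.Subset using (Subset; ⊤; ∣_∣)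
open import Data.Product using (Σ; _×_)
open import Data.Sum using (_⊎_)

open import Level using (0ℓ)
open import Data.Nat using (zero; suc; _<_; _+_; _*_; z≤n; s≤s; _≤?_; _<?_)
open import Data.Nat.Properties
open import Data.Fin using (zero; suc)
open import Data.Fin.Subset using (_∈_; _∉_; _⊆_; _⊂_; ⊥; ⁅_⁆; _∪_; _∩_; inside; outside; Empty)
open import Data.Fin.Subset.Properties
  using (_∈?_; ∉⊥; x∈⁅x⁆; x∈⁅y⁆⇒x≡y; ∣⁅x⁆∣≡1; ∣⊥∣≡0; ∣⊤∣≡n; Empty-unique; p⊆p∪q; q⊆p∪q; x∈p∪q⁻; x∈p∩q⁺;
         p⊆q⇒∣p∣≤∣q∣; p⊂q⇒∣p∣<∣q∣; x∈p⇒∣p-x∣<∣p∣)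
open import Data.Fin.Subset.Induction using (⊂-wellFounded)
open import Data.Vec using ([]; _∷_; here; there)
open import Data.Product using (_,_; proj₁; proj₂; ∃-syntax)
open import Data.Sum using (inj₁; inj₂)
open import Data.Empty using (⊥-elim)
open import Function using (_∘_)
open import Induction.WellFounded using (Acc; acc)
open import Relation.Binary.Bundles using (TotalPreorder)
import Relation.Binary.Construct.Flip.EqAndOrd as Flip
open import Relation.Binary.PropositionalEquality using (_≡_; _≢_; refl; sym; trans; cong; subst)
open import Relation.Nullary using (¬_; yes; no; does)
open import Relation.Nullary.Decidable using (_×-dec_)
open import Relation.Unary using (Pred; Decidable)

module _ {a ℓ₁ ℓ₂} (O : TotalPreorder a ℓ₁ ℓ₂) where
  open TotalPreorder O using (Carrier; _≲_; total) renaming (refl to ≲-refl; trans to ≲-trans)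

  least : ∀ {m} (key : Fin m → Carrier) {P : Pred (Fin m) 0ℓ} → Decidable P →
          (∀ x → ¬ P x) ⊎ ∃[ x ] P x × (∀ y → P y → key x ≲ key y)
  least {zero} key P? = inj₁ λ ()
  least {suc m} key {P} P? with least (key ∘ suc) {P ∘ suc} (P? ∘ suc) | P? zero
  ... | inj₁ none | yes p₀ = inj₂ (zero , p₀ , λ { zero _ → ≲-refl ; (suc y) py → ⊥-elim (none y py) })
  ... | inj₁ none | no ¬p₀ = inj₁ λ { zero → ¬p₀ ; (suc y) → none y }
  ... | inj₂ (x , px , x-least) | no ¬p₀ =
    inj₂ (suc x , px , λ { zero p₀ → ⊥-elim (¬p₀ p₀) ; (suc y) py → x-least y py })
  ... | inj₂ (x , px , x-least) | yes p₀ with total (key zero) (key (suc x))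
  ...   | inj₁ 0≲x = inj₂ (zero , p₀ , λ { zero _ → ≲-refl ; (suc y) py → ≲-trans 0≲x (x-least y py) })
  ...   | inj₂ x≲0 = inj₂ (suc x , px , λ { zero _ → x≲0 ; (suc y) py → x-least y py })

select : ∀ {m} {P : Pred (Fin m) 0ℓ} → Decidable P → Subset m
select {zero} P? = []
select {suc m} P? = does (P? zero) ∷ select (P? ∘ suc)

select⁺ : ∀ {m} {P : Pred (Fin m) 0ℓ} (P? : Decidable P) {x} → P x → x ∈ select P?
select⁺ P? {zero} p with P? zero
... | yes _ = here
... | no ¬p = ⊥-elim (¬p p)
select⁺ P? {suc x} p = there (select⁺ (P? ∘ suc) p)

select⁻ : ∀ {m} {P : Pred (Fin m) 0ℓ} (P? : Decidable P) {x} → x ∈ select P? → P x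
select⁻ P? {zero} x∈ with P? zero | x∈
... | yes p | _ = p
... | no _ | ()
select⁻ P? {suc x} (there x∈) = select⁻ (P? ∘ suc) x∈

∈-∪⁅⁆⁻ : ∀ {m} {p : Subset m} {x y} → x ∈ p ∪ ⁅ y ⁆ → x ∈ p ⊎ x ≡ y
∈-∪⁅⁆⁻ {p = p} {y = y} x∈ with x∈p∪q⁻ p ⁅ y ⁆ x∈
... | inj₁ x∈p = inj₁ x∈p
... | inj₂ x∈y = inj₂ (x∈⁅y⁆⇒x≡y y x∈y)

y∈p∪⁅y⁆ : ∀ {m} (p : Subset m) (y : Fin m) → y ∈ p ∪ ⁅ y ⁆
y∈p∪⁅y⁆ p y = q⊆p∪q p ⁅ y ⁆ (x∈⁅x⁆ y)

∣p∣<∣p∪⁅y⁆∣ : ∀ {m} {p : Subset m} {y} → y ∉ p → ∣ p ∣ < ∣ p ∪ ⁅ y ⁆ ∣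
∣p∣<∣p∪⁅y⁆∣ {p = p} {y} y∉p = p⊂q⇒∣p∣<∣q∣ (p⊆p∪q ⁅ y ⁆ , y , y∈p∪⁅y⁆ p y , y∉p)

∣p∪q∣+∣p∩q∣≡∣p∣+∣q∣ : ∀ {m} (p q : Subset m) → ∣ p ∪ q ∣ + ∣ p ∩ q ∣ ≡ ∣ p ∣ + ∣ q ∣
∣p∪q∣+∣p∩q∣≡∣p∣+∣q∣ [] [] = refl
∣p∪q∣+∣p∩q∣≡∣p∣+∣q∣ (inside ∷ p) (inside ∷ q) =
  cong suc (trans (+-suc (∣ p ∪ q ∣) (∣ p ∩ q ∣))
                  (trans (cong suc (∣p∪q∣+∣p∩q∣≡∣p∣+∣q∣ p q)) (sym (+-suc (∣ p ∣) (∣ q ∣)))))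
∣p∪q∣+∣p∩q∣≡∣p∣+∣q∣ (inside ∷ p) (outside ∷ q) = cong suc (∣p∪q∣+∣p∩q∣≡∣p∣+∣q∣ p q)
∣p∪q∣+∣p∩q∣≡∣p∣+∣q∣ (outside ∷ p) (inside ∷ q) =
  trans (cong suc (∣p∪q∣+∣p∩q∣≡∣p∣+∣q∣ p q)) (sym (+-suc (∣ p ∣) (∣ q ∣)))
∣p∪q∣+∣p∩q∣≡∣p∣+∣q∣ (outside ∷ p) (outside ∷ q) = ∣p∪q∣+∣p∩q∣≡∣p∣+∣q∣ p q

-- A set covered by one point f and two sets p, q sharing a point g has at most
-- ∣p∣ + ∣q∣ elements: the extra point f is paid for by the overlap g.
cover-size : ∀ {m} {S p q : Subset m} {f g} → S ⊆ ⁅ f ⁆ ∪ (p ∪ q) → g ∈ p → g ∈ q → ∣ S ∣ ≤ ∣ p ∣ + ∣ q ∣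
cover-size {S = S} {p} {q} {f} S⊆ g∈p g∈q = begin
  ∣ S ∣                   ≤⟨ p⊆q⇒∣p∣≤∣q∣ S⊆ ⟩
  ∣ ⁅ f ⁆ ∪ (p ∪ q) ∣     ≤⟨ ≤-trans (m≤m+n _ _) (≤-reflexive (∣p∪q∣+∣p∩q∣≡∣p∣+∣q∣ ⁅ f ⁆ (p ∪ q))) ⟩
  ∣ ⁅ f ⁆ ∣ + ∣ p ∪ q ∣   ≡⟨ cong (_+ ∣ p ∪ q ∣) (∣⁅x⁆∣≡1 f) ⟩
  1 + ∣ p ∪ q ∣           ≡⟨ +-comm 1 (∣ p ∪ q ∣) ⟩
  ∣ p ∪ q ∣ + 1           ≤⟨ +-monoʳ-≤ (∣ p ∪ q ∣) one≤overlap ⟩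
  ∣ p ∪ q ∣ + ∣ p ∩ q ∣   ≡⟨ ∣p∪q∣+∣p∩q∣≡∣p∣+∣q∣ p q ⟩
  ∣ p ∣ + ∣ q ∣           ∎
  where
  open ≤-Reasoning
  one≤overlap : 1 ≤ ∣ p ∩ q ∣
  one≤overlap = <-≤-trans (s≤s z≤n) (x∈p⇒∣p-x∣<∣p∣ (x∈p∩q⁺ (g∈p , g∈q)))

larger : ∀ {m} (A : Subset m → Set) {H₁ H₂} → A H₁ → A H₂ →
         Σ (Subset m) λ H → A H × ∣ H₁ ∣ ≤ ∣ H ∣ × ∣ H₂ ∣ ≤ ∣ H ∣
larger A {H₁} {H₂} a₁ a₂ with ≤-total (∣ H₁ ∣) (∣ H₂ ∣)
... | inj₁ 1≤2 = H₂ , a₂ , 1≤2 , ≤-refl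
... | inj₂ 2≤1 = H₁ , a₁ , ≤-refl , 2≤1

-- sizeBound c h bounds the size of a set of clique number ≤ c by the size h of
-- an admissible subgraph: h^(c-1), and 0 when c = 0 (the set is then empty).
sizeBound : ℕ → ℕ → ℕ
sizeBound zero _ = 0
sizeBound (suc c) h = h ^ c

sizeBound-mono : ∀ c {a b} → a ≤ b → sizeBound c a ≤ sizeBound c b
sizeBound-mono zero _ = z≤n
sizeBound-mono (suc c) a≤b = ^-monoˡ-≤ c a≤b

-- One step of the decomposition: a block of size a and a remainder with m steps.
extend-bound : ∀ c {a b m x y z} → a ≤ sizeBound c x → b ≤ suc (m * sizeBound c y) →
               x ≤ z → y ≤ z → a + b ≤ suc (suc m * sizeBound c z)
extend-bound c {a} {b} {m} {x} {y} {z} a≤ b≤ x≤z y≤z = begin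
  a + b                 ≤⟨ +-mono-≤ (≤-trans a≤ (sizeBound-mono c x≤z))
                                    (≤-trans b≤ (s≤s (*-monoʳ-≤ m (sizeBound-mono c y≤z)))) ⟩
  φ + suc (m * φ)       ≡⟨ +-suc φ (m * φ) ⟩
  suc (suc m * φ)       ∎
  where
  open ≤-Reasoning
  φ = sizeBound c z

power-bound : ∀ c {m x M} → suc m ≤ M → x ≤ M → suc (m * sizeBound c x) ≤ M ^ c
power-bound zero {m} _ _ = s≤s (≤-reflexive (*-zeroʳ m))
power-bound (suc c) {m} {x} {M} m<M x≤M = begin
  suc (m * x ^ c)       ≤⟨ s≤s (*-monoʳ-≤ m (^-monoˡ-≤ c x≤M)) ⟩
  1 + m * M ^ c         ≤⟨ +-monoˡ-≤ (m * M ^ c) 1≤M^c ⟩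
  suc m * M ^ c         ≤⟨ *-monoˡ-≤ (M ^ c) m<M ⟩
  M ^ suc c             ∎
  where
  open ≤-Reasoning
  1≤M^c : 1 ≤ M ^ c
  1≤M^c = ≤-trans (≤-reflexive (sym (^-zeroˡ c))) (^-monoˡ-≤ c (≤-trans (s≤s z≤n) m<M))

module IntervalGraph {n : ℕ} (R : IntervalRep n) where

  left right : Fin n → ℕ
  left = l R
  right = r R

  left-< : ∀ {v w} → left v ≤ left w → v ≢ w → left v < left w
  left-< v≤w v≢w = ≤∧≢⇒< v≤w (v≢w ∘ l-inj R _ _)

  left-<⇒≢ : ∀ {v w} → left v < left w → v ≢ w
  left-<⇒≢ v<w refl = <-irrefl refl v<w

  left-antisym : ∀ {v w} → left v ≤ left w → left w ≤ left v → v ≡ w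
  left-antisym v≤w w≤v = l-inj R _ _ (≤-antisym v≤w w≤v)

  first-unique : ∀ {T v w} → FirstIn R T v → FirstIn R T w → v ≡ w
  first-unique (v∈ , v-first) (w∈ , w-first) = left-antisym (v-first _ w∈) (w-first _ v∈)

  adj-sym : ∀ {v w} → Adj R v w → Adj R w v
  adj-sym (v≢w , a , b) = (v≢w ∘ sym) , b , a

  adj-intro : ∀ {v w} → left v < left w → left w ≤ right v → Adj R v w
  adj-intro {v} {w} v<w w≤rv = left-<⇒≢ v<w , ≤-trans (<⇒≤ v<w) (<⇒≤ (l<r R w)) , w≤rv

  adj-reach : ∀ {v w} → Adj R v w → left v < left w → left w < right v
  adj-reach (_ , _ , w≤rv) _ = ≤∧≢⇒< w≤rv (l≢r R _ _)

  empty-or-first : ∀ T → Empty T ⊎ ∃[ f ] FirstIn R T f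
  empty-or-first T with least ≤-totalPreorder left (_∈? T)
  ... | inj₁ none = inj₁ λ (x , x∈T) → none x x∈T
  ... | inj₂ (f , f∈T , f-least) = inj₂ (f , f∈T , f-least)

  last-or-successor : ∀ {T v} → v ∈ T → LastIn R T v ⊎ ∃[ w ] Successor R T v w
  last-or-successor {T} {v} v∈T with least ≤-totalPreorder left (λ y → (y ∈? T) ×-dec (left v <? left y))
  ... | inj₁ none = inj₁ (v∈T , λ u u∈T → ≮⇒≥ λ v<u → none u (u∈T , v<u))
  ... | inj₂ (w , (w∈T , v<w) , w-least) =
    inj₂ (w , v∈T , w∈T , v<w , λ u u∈T (v<u , u<w) → <⇒≱ u<w (w-least u (u∈T , v<u)))

  successor-⊆ : ∀ {S T v w} → T ⊆ S → v ∈ T → w ∈ T → Successor R S v w → Successor R T v w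
  successor-⊆ T⊆S v∈T w∈T (_ , _ , v<w , between) = v∈T , w∈T , v<w , λ u u∈T → between u (T⊆S u∈T)

  Convex : Subset n → Subset n → Set
  Convex T S = T ⊆ S × (∀ {x y z} → x ∈ T → z ∈ T → y ∈ S → left x < left y → left y < left z → y ∈ T)

  -- Successors in a convex part are successors in S, so consecutive adjacency is inherited.
  consecAdj-convex : ∀ {S T} → ConsecAdj R S → Convex T S → ConsecAdj R T
  consecAdj-convex S-adj (T⊆S , convex) v w (v∈ , w∈ , v<w , between) =
    S-adj v w (T⊆S v∈ , T⊆S w∈ , v<w , λ u u∈S (v<u , u<w) → between u (convex v∈ w∈ u∈S v<u u<w) (v<u , u<w))

  window : (I : Pred ℕ 0ℓ) → Decidable I → Subset n → Subset n
  window I I? S = select (λ x → (x ∈? S) ×-dec I? (left x))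

  window⁺ : ∀ {I : Pred ℕ 0ℓ} (I? : Decidable I) {S x} → x ∈ S → I (left x) → x ∈ window I I? S
  window⁺ I? {S} x∈S ix = select⁺ (λ x → (x ∈? S) ×-dec I? (left x)) (x∈S , ix)

  window⁻ : ∀ {I : Pred ℕ 0ℓ} (I? : Decidable I) {S x} → x ∈ window I I? S → x ∈ S × I (left x)
  window⁻ I? {S} = select⁻ (λ x → (x ∈? S) ×-dec I? (left x))

  window-convex : ∀ {I : Pred ℕ 0ℓ} (I? : Decidable I) {S} →
                  (∀ {a b c} → I a → I c → a ≤ b → b ≤ c → I b) → Convex (window I I? S) S
  window-convex I? interval =
    (λ x∈ → proj₁ (window⁻ I? x∈)) ,
    λ x∈ z∈ y∈S x<y y<z →
      window⁺ I? y∈S (interval (proj₂ (window⁻ I? x∈)) (proj₂ (window⁻ I? z∈)) (<⇒≤ x<y) (<⇒≤ y<z))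

  CliqueBound : Subset n → ℕ → Set
  CliqueBound S c = ∀ Q → Q ⊆ S → IsClique R Q → ∣ Q ∣ ≤ c

  cliqueBound-⊆ : ∀ {S T c} → T ⊆ S → CliqueBound S c → CliqueBound T c
  cliqueBound-⊆ T⊆S bound Q Q⊆T = bound Q (λ x∈ → T⊆S (Q⊆T x∈))

  singleton-clique : ∀ x → IsClique R ⁅ x ⁆
  singleton-clique x a b a∈ b∈ a≢b = ⊥-elim (a≢b (trans (x∈⁅y⁆⇒x≡y x a∈) (sym (x∈⁅y⁆⇒x≡y x b∈))))

  -- Common neighbours of a vertex f of S have a clique bound one smaller,
  -- since f extends each of their cliques.
  cliqueBound-neighbours : ∀ {S B f c} → CliqueBound S (suc c) → f ∈ S → B ⊆ S →
                           (∀ {x} → x ∈ B → Adj R f x) → CliqueBound B c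
  cliqueBound-neighbours {S} {B} {f} bound f∈S B⊆S f~B Q Q⊆B Q-clique =
    ≤-pred (≤-trans (∣p∣<∣p∪⁅y⁆∣ f∉Q) (bound (Q ∪ ⁅ f ⁆) Q⁺⊆S Q⁺-clique))
    where
    f∉Q : f ∉ Q
    f∉Q f∈Q = proj₁ (f~B (Q⊆B f∈Q)) refl
    Q⁺⊆S : Q ∪ ⁅ f ⁆ ⊆ S
    Q⁺⊆S x∈ with ∈-∪⁅⁆⁻ x∈
    ... | inj₁ x∈Q = B⊆S (Q⊆B x∈Q)
    ... | inj₂ refl = f∈S
    Q⁺-clique : IsClique R (Q ∪ ⁅ f ⁆)
    Q⁺-clique a b a∈ b∈ a≢b with ∈-∪⁅⁆⁻ a∈ | ∈-∪⁅⁆⁻ b∈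
    ... | inj₁ a∈Q | inj₁ b∈Q = Q-clique a b a∈Q b∈Q a≢b
    ... | inj₁ a∈Q | inj₂ refl = adj-sym (f~B (Q⊆B a∈Q))
    ... | inj₂ refl | inj₁ b∈Q = f~B (Q⊆B b∈Q)
    ... | inj₂ refl | inj₂ refl = ⊥-elim (a≢b refl)

  Admissible : Subset n → Set
  Admissible H = ConsecAdj R H × (∀ v → Simplicial R H v → FirstIn R H v ⊎ LastIn R H v)

  admissible-subsingleton : ∀ {H} → (∀ {v w} → v ∈ H → w ∈ H → v ≡ w) → Admissible H
  admissible-subsingleton same =
    (λ v w (v∈ , w∈ , v<w , _) → ⊥-elim (left-<⇒≢ v<w (same v∈ w∈))) ,
    λ v (v∈ , _) → inj₁ (v∈ , λ u u∈ → ≤-reflexive (cong left (same v∈ u∈)))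

  admissible-⊥ : Admissible ⊥
  admissible-⊥ = admissible-subsingleton λ v∈ → ⊥-elim (∉⊥ v∈)

  simplicial-⊆ : ∀ {S T v} → T ⊆ S → v ∈ T → Simplicial R S v → Simplicial R T v
  simplicial-⊆ T⊆S v∈T (_ , clique) = v∈T , λ a b a∈ b∈ → clique a b (T⊆S a∈) (T⊆S b∈)

  -- Prepending f to an admissible P keeps it admissible, provided f precedes the
  -- first vertex g of P and g is f's only neighbour in P. If g became an inner
  -- vertex, its successor would have to be adjacent to f by simpliciality of g.
  prepend : ∀ {P f g} → Admissible P → FirstIn R P g → left f < left g → Adj R f g →
            (∀ v → v ∈ P → v ≢ g → ¬ Adj R f v) →
            Admissible (P ∪ ⁅ f ⁆) × FirstIn R (P ∪ ⁅ f ⁆) f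
  prepend {P} {f} {g} (P-adj , P-simp) (g∈P , g-first) f<g f~g f≁P = (consec , simp) , first
    where
    P⊆P⁺ : P ⊆ P ∪ ⁅ f ⁆
    P⊆P⁺ = p⊆p∪q ⁅ f ⁆
    f<P : ∀ {u} → u ∈ P → left f < left u
    f<P u∈P = <-≤-trans f<g (g-first _ u∈P)
    first : FirstIn R (P ∪ ⁅ f ⁆) f
    first = y∈p∪⁅y⁆ P f , λ u u∈ → f≤ (∈-∪⁅⁆⁻ u∈)
      where
      f≤ : ∀ {u} → u ∈ P ⊎ u ≡ f → left f ≤ left u
      f≤ (inj₁ u∈P) = <⇒≤ (f<P u∈P)
      f≤ (inj₂ refl) = ≤-refl
    last : ∀ {v} → LastIn R P v → LastIn R (P ∪ ⁅ f ⁆) v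
    last {v} (v∈P , v-last) = P⊆P⁺ v∈P , λ u u∈ → ≤v (∈-∪⁅⁆⁻ u∈)
      where
      ≤v : ∀ {u} → u ∈ P ⊎ u ≡ f → left u ≤ left v
      ≤v (inj₁ u∈P) = v-last _ u∈P
      ≤v (inj₂ refl) = <⇒≤ (f<P v∈P)
    consec : ConsecAdj R (P ∪ ⁅ f ⁆)
    consec v w s@(v∈ , w∈ , v<w , between) with ∈-∪⁅⁆⁻ v∈ | ∈-∪⁅⁆⁻ w∈
    ... | inj₂ refl | inj₂ refl = ⊥-elim (<-irrefl refl v<w)
    ... | inj₁ v∈P | inj₂ refl = ⊥-elim (<-asym v<w (f<P v∈P))
    ... | inj₁ v∈P | inj₁ w∈P = P-adj v w (successor-⊆ P⊆P⁺ v∈P w∈P s)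
    ... | inj₂ refl | inj₁ w∈P with left-antisym (≮⇒≥ λ g<w → between g (P⊆P⁺ g∈P) (f<g , g<w)) (g-first w w∈P)
    ...   | refl = f~g
    g-last : Simplicial R (P ∪ ⁅ f ⁆) g → LastIn R P g
    g-last (_ , clique) with last-or-successor g∈P
    ... | inj₁ g-last = g-last
    ... | inj₂ (w , s@(_ , w∈P , g<w , _)) =
      ⊥-elim (f≁P w w∈P (left-<⇒≢ g<w ∘ sym)
               (clique f w (y∈p∪⁅y⁆ P f) (P⊆P⁺ w∈P) (adj-sym f~g) (P-adj g w s) (left-<⇒≢ (f<P w∈P))))
    simp : ∀ v → Simplicial R (P ∪ ⁅ f ⁆) v → FirstIn R (P ∪ ⁅ f ⁆) v ⊎ LastIn R (P ∪ ⁅ f ⁆) v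
    simp v v-simp@(v∈ , _) with ∈-∪⁅⁆⁻ v∈
    ... | inj₂ refl = inj₁ first
    ... | inj₁ v∈P with P-simp v (simplicial-⊆ P⊆P⁺ v∈P v-simp)
    ...   | inj₂ v-last = inj₂ (last v-last)
    ...   | inj₁ v-first with first-unique v-first (g∈P , g-first)
    ...     | refl = inj₂ (last (g-last v-simp))

  Bounded : ℕ → Set
  Bounded c = ∀ S → ConsecAdj R S → CliqueBound S c →
              Σ (Subset n) λ H → Admissible H × ∣ S ∣ ≤ sizeBound c ∣ H ∣

  bounded-empty : ∀ c {S : Subset n} → Empty S → Σ (Subset n) λ H → Admissible H × ∣ S ∣ ≤ sizeBound c ∣ H ∣
  bounded-empty c empty = ⊥ , admissible-⊥ , ≤-trans (≤-reflexive (trans (cong ∣_∣ (Empty-unique empty)) (∣⊥∣≡0 n))) z≤n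

  -- A decomposition of S starting at its first vertex f: an admissible path in S
  -- beginning with f, and an admissible block H, such that S consists of f and
  -- at most ∣path∣-1 parts, each bounded via ∣H∣.
  record Decomposition (c : ℕ) (S : Subset n) (f : Fin n) : Set where
    field
      path block : Subset n
      steps : ℕ
      path-admissible : Admissible path
      block-admissible : Admissible block
      path-first : FirstIn R path f
      path-⊆ : path ⊆ S
      path-length : suc steps ≤ ∣ path ∣
      size : ∣ S ∣ ≤ suc (steps * sizeBound c ∣ block ∣)

  trivial-decomposition : ∀ {c S f} → f ∈ S → (∀ {x} → x ∈ S → x ≡ f) → Decomposition c S f
  trivial-decomposition {S = S} {f} f∈S only-f = record
    { path = ⁅ f ⁆ ; block = ⁅ f ⁆ ; steps = 0
    ; path-admissible = singleton ; block-admissible = singleton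
    ; path-first = x∈⁅x⁆ f , λ u u∈ → ≤-reflexive (cong left (sym (x∈⁅y⁆⇒x≡y f u∈)))
    ; path-⊆ = λ x∈ → subst (_∈ S) (sym (x∈⁅y⁆⇒x≡y f x∈)) f∈S
    ; path-length = ≤-reflexive (sym (∣⁅x⁆∣≡1 f))
    ; size = ≤-trans (p⊆q⇒∣p∣≤∣q∣ (λ x∈ → subst (_∈ ⁅ f ⁆) (sym (only-f x∈)) (x∈⁅x⁆ f))) (≤-reflexive (∣⁅x⁆∣≡1 f))
    }
    where
    singleton : Admissible ⁅ f ⁆
    singleton = admissible-subsingleton λ v∈ w∈ → trans (x∈⁅y⁆⇒x≡y f v∈) (sym (x∈⁅y⁆⇒x≡y f w∈))

  farthest-neighbour : ∀ {S f s} → s ∈ S → left f < left s → Adj R f s →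
    ∃[ g ] g ∈ S × left f < left g × Adj R f g × (∀ {x} → x ∈ S → left g < left x → ¬ Adj R f x)
  farthest-neighbour {S} {f} s∈S f<s f~s
    with least (Flip.totalPreorder ≤-totalPreorder) left
                (λ x → (x ∈? S) ×-dec (left f <? left x) ×-dec (left x <? right f))
  ... | inj₁ none = ⊥-elim (none _ (s∈S , f<s , adj-reach f~s f<s))
  ... | inj₂ (g , (g∈S , f<g , g<rf) , g-last) =
    g , g∈S , f<g , adj-intro f<g (<⇒≤ g<rf) ,
    λ x∈S g<x f~x → <⇒≱ g<x (g-last _ (x∈S , <-trans f<g g<x , adj-reach f~x (<-trans f<g g<x)))

  module Split {S f g} (f-first : FirstIn R S f) (g∈S : g ∈ S) (f<g : left f < left g) (f~g : Adj R f g) where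

    from-g? : Decidable (left g ≤_)
    from-g? = left g ≤?_

    after-f-up-to-g? : Decidable (λ a → left f < a × a ≤ left g)
    after-f-up-to-g? a = left f <? a ×-dec a ≤? left g

    S' B : Subset n
    S' = window _ from-g? S
    B = window _ after-f-up-to-g? S

    S'-convex : Convex S' S
    S'-convex = window-convex from-g? λ g≤a _ a≤b _ → ≤-trans g≤a a≤b

    B-convex : Convex B S
    B-convex = window-convex after-f-up-to-g? λ (f<a , _) (_ , c≤g) a≤b b≤c → <-≤-trans f<a a≤b , ≤-trans b≤c c≤g

    g-first' : FirstIn R S' g
    g-first' = window⁺ from-g? g∈S ≤-refl , λ u u∈ → proj₂ (window⁻ from-g? u∈)

    g∈B : g ∈ B
    g∈B = window⁺ after-f-up-to-g? g∈S (f<g , ≤-refl)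

    f∉S' : f ∉ S'
    f∉S' f∈S' = <⇒≱ f<g (proj₂ (window⁻ from-g? f∈S'))

    S'⊂S : S' ⊂ S
    S'⊂S = proj₁ S'-convex , f , proj₁ f-first , f∉S'

    -- every vertex of B starts inside the interval of f
    f~B : ∀ {x} → x ∈ B → Adj R f x
    f~B x∈ with window⁻ after-f-up-to-g? x∈
    ... | _ , f<x , x≤g = adj-intro f<x (<⇒≤ (≤-<-trans x≤g (adj-reach f~g f<g)))

    covered : S ⊆ ⁅ f ⁆ ∪ (B ∪ S')
    covered {x} x∈S with left f <? left x
    ... | no f≮x with left-antisym (≮⇒≥ f≮x) (proj₂ f-first x x∈S)
    ...   | refl = p⊆p∪q (B ∪ S') (x∈⁅x⁆ x)
    covered {x} x∈S | yes f<x with left x ≤? left g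
    ...   | yes x≤g = q⊆p∪q ⁅ f ⁆ (B ∪ S') (p⊆p∪q S' (window⁺ after-f-up-to-g? x∈S (f<x , x≤g)))
    ...   | no x≰g = q⊆p∪q ⁅ f ⁆ (B ∪ S') (q⊆p∪q B S' (window⁺ from-g? x∈S (<⇒≤ (≰⇒> x≰g))))

  -- Every S with consecutive adjacency, clique bound c+1 and first vertex f has
  -- a decomposition, by well-founded recursion on S: split at the farthest later
  -- neighbour g of f, bound the block by the hypothesis for c, decompose the
  -- tail and prepend f to its path.
  decompose : ∀ {c} → Bounded c → ∀ S {f} → Acc _⊂_ S → ConsecAdj R S → CliqueBound S (suc c) →
              FirstIn R S f → Decomposition c S f
  decompose {c} bounded S {f} (acc smaller) S-adj S-bound f-first@(f∈S , f≤S) with last-or-successor f∈S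
  ... | inj₁ (_ , S≤f) = trivial-decomposition f∈S λ x∈ → left-antisym (S≤f _ x∈) (f≤S _ x∈)
  ... | inj₂ (s , f⇢s@(_ , s∈S , f<s , _)) with farthest-neighbour s∈S f<s (S-adj f s f⇢s)
  ...   | g , g∈S , f<g , f~g , beyond = extend tail
    where
    open Split f-first g∈S f<g f~g
    tail : Decomposition c S' g
    tail = decompose bounded S' (smaller S'⊂S) (consecAdj-convex S-adj S'-convex)
             (cliqueBound-⊆ (proj₁ S'-convex) S-bound) g-first'
    block-bound : Σ (Subset n) λ H → Admissible H × ∣ B ∣ ≤ sizeBound c ∣ H ∣
    block-bound = bounded B (consecAdj-convex S-adj B-convex)
                    (cliqueBound-neighbours S-bound f∈S (proj₁ B-convex) f~B)
    extend : Decomposition c S' g → Decomposition c S f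
    extend D =
      let (HB , HB-admissible , B≤HB) = block-bound
          (H , H-admissible , HB≤H , block≤H) = larger Admissible HB-admissible block-admissible
      in record
      { path = path ∪ ⁅ f ⁆ ; block = H ; steps = suc steps
      ; path-admissible = proj₁ prepended ; block-admissible = H-admissible
      ; path-first = proj₂ prepended
      ; path-⊆ = λ x∈ → path∪f⊆S (∈-∪⁅⁆⁻ x∈)
      ; path-length = ≤-trans (s≤s path-length) (∣p∣<∣p∪⁅y⁆∣ (f∉S' ∘ path-⊆))
      ; size = ≤-trans (cover-size covered g∈B (proj₁ g-first')) (extend-bound c {m = steps} B≤HB size HB≤H block≤H)
      }
      where
      open Decomposition D
      -- by the choice of g, f has no neighbour on the tail except g
      f≁path : ∀ v → v ∈ path → v ≢ g → ¬ Adj R f v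
      f≁path v v∈ v≢g with window⁻ from-g? (path-⊆ v∈)
      ... | v∈S , g≤v = beyond v∈S (left-< g≤v (v≢g ∘ sym))
      prepended : Admissible (path ∪ ⁅ f ⁆) × FirstIn R (path ∪ ⁅ f ⁆) f
      prepended = prepend path-admissible path-first f<g f~g f≁path
      path∪f⊆S : ∀ {x} → x ∈ path ⊎ x ≡ f → x ∈ S
      path∪f⊆S (inj₁ x∈) = proj₁ S'-convex (path-⊆ x∈)
      path∪f⊆S (inj₂ refl) = f∈S

  -- For c = 0 the set is
  -- empty, as any vertex would be a clique of size 1; otherwise decompose S
  -- and take the larger of the path and the block.
  bounded : ∀ c → Bounded c
  bounded zero S _ S-bound = bounded-empty zero λ (x , x∈S) →
    <⇒≱ (s≤s z≤n) (≤-trans (≤-reflexive (sym (∣⁅x⁆∣≡1 x)))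
                    (S-bound ⁅ x ⁆ (λ y∈ → subst (_∈ S) (sym (x∈⁅y⁆⇒x≡y x y∈)) x∈S) (singleton-clique x)))
  bounded (suc c) S S-adj S-bound with empty-or-first S
  ... | inj₁ empty = bounded-empty (suc c) empty
  ... | inj₂ (f , f-first) =
    let (H , H-admissible , path≤H , block≤H) = larger Admissible path-admissible block-admissible
    in H , H-admissible , ≤-trans size (power-bound c {m = steps} (≤-trans path-length path≤H) block≤H)
    where
    open Decomposition (decompose (bounded c) S (⊂-wellFounded S) S-adj S-bound f-first)

lemma17 : (n : ℕ) (R : IntervalRep n) (k : ℕ) → 2 ≤ k → MaxCliqueSize R k
    → ConsecAdj R ⊤
    → Σ (Subset n) λ H → (n ≤ ∣ H ∣ ^ (k ∸ 1)) × ConsecAdj R H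
    × (∀ v → Simplicial R H v → FirstIn R H v ⊎ LastIn R H v)
lemma17 n R (suc (suc k)) (s≤s (s≤s z≤n)) (_ , maximum) consecutive
  with IntervalGraph.bounded R (suc (suc k)) ⊤ consecutive (λ Q _ → maximum Q)
... | H , (H-adj , H-simplicial) , size = H , subst (_≤ ∣ H ∣ ^ suc k) (∣⊤∣≡n n) size , H-adj , H-simplicial
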